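{- For every raw context $\Gamma$ of Glob such that $\Gamma\vdash_{ps}$, the relation $x\triangleleft_\Gamma y$ is a linear order on the variables of $\Gamma$ (a strict total order: irreflexive, transitive, and any two distinct variables of $\Gamma$ are comparable).
   Context: Meta-theory: Martin-Löf type theory without axiom K. Raw syntax of Glob: raw types $*$ and $\Rightarrow(A,t,u)$; raw terms $\mathrm{Var}\,x$, $x\in\mathbb{N}$; raw contexts finite lists of pairs $(x,A)$ ($\mathrm{nil}$ empty, $L::p$ appends $p$, $\ell(L)$ length); the variables of $\Gamma$ are the first components of its pairs. Glob judgements $\Gamma\vdash$, $\Gamma\vdash A$, $\Gamma\vdash t:A$ are generated by: (ec) $\mathrm{nil}\vdash$; (cc) from $\Gamma\vdash$, $\Gamma\vdash A$, $x=\ell(\Gamma)$ derive $\Gamma::(x,A)\vdash$; (ob) from $\Gamma\vdash$ derive $\Gamma\vdash *$; (ar) from $\Gamma\vdash t:A$, $\Gamma\vdash u:A$ derive $\Gamma\vdash\Rightarrow(A,t,u)$; (var) from $\Gamma\vdash$ and $(x,A)\in\Gamma$ derive $\Gamma\vdash\mathrm{Var}\,x:A$. Ps-judgements: $\Gamma\vdash_{ps}x:A$ is generated by (pss) $\mathrm{nil}::(0,*)\vdash_{ps}0:*$; (psd) from $\Gamma\vdash_{ps}f:\Rightarrow(A,\mathrm{Var}\,x,\mathrm{Var}\,y)$ derive $\Gamma\vdash_{ps}y:A$; (pse) from $\Gamma\vdash_{ps}x:A$, with $l=\ell(\Gamma)$, derive $(\Gamma::(l,A))::(l+1,\Rightarrow(A,\mathrm{Var}\,x,\mathrm{Var}\,l))\vdash_{ps}l+1:\Rightarrow(A,\mathrm{Var}\,x,\mathrm{Var}\,l)$;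 and $\Gamma\vdash_{ps}$ holds when $\Gamma\vdash_{ps}x:*$ for some $x$. The relation $\triangleleft_{0,\Gamma}$: $x\triangleleft_{0,\Gamma}y$ if there are $A,z$ with $\Gamma\vdash\mathrm{Var}\,y:\Rightarrow(A,\mathrm{Var}\,x,\mathrm{Var}\,z)$, or there are $A,z$ with $\Gamma\vdash\mathrm{Var}\,x:\Rightarrow(A,\mathrm{Var}\,z,\mathrm{Var}\,y)$. $\triangleleft_\Gamma$ is its transitive closure. -}

module Defs where

open import Data.Nat using (ℕ; zero; suc; _+_)
open import Data.Product using (Σ; _×_; _,_; ∃)
open import Data.Sum using (_⊎_)
open import Relation.Binary.PropositionalEquality using (_≡_)
open import Relation.Nullary using (¬_)
open import Relation.Binary.Construct.Closure.Transitive using (TransClosure)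

mutual
  data Ty : Set where
    ⋆   : Ty
    ⇒   : Ty → Tm → Tm → Ty

  data Tm : Set where
    Var : ℕ → Tm

infixl 5 _::_
data Ctx : Set where
  nil  : Ctx
  _::_ : Ctx → ℕ × Ty → Ctx

ℓ : Ctx → ℕ
ℓ nil      = 0
ℓ (Γ :: _) = suc (ℓ Γ)

data _∈C_ (p : ℕ × Ty) : Ctx → Set where
  here  : ∀ {Γ} → p ∈C (Γ :: p)
  there : ∀ {Γ q} → p ∈C Γ → p ∈C (Γ :: q)

_∈vars_ : ℕ → Ctx → Set
x ∈vars Γ = ∃ λ A → (x , A) ∈C Γ

mutual
  data _⊢ : Ctx → Set where
    ec : nil ⊢
    cc : ∀ {Γ A x} → Γ ⊢ → Γ ⊢T A → x ≡ ℓ Γ → (Γ :: (x , A)) ⊢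

  data _⊢T_ : Ctx → Ty → Set where
    ob : ∀ {Γ} → Γ ⊢ → Γ ⊢T ⋆
    ar : ∀ {Γ A t u} → Γ ⊢t t ∶ A → Γ ⊢t u ∶ A → Γ ⊢T ⇒ A t u

  data _⊢t_∶_ : Ctx → Tm → Ty → Set where
    var : ∀ {Γ x A} → Γ ⊢ → (x , A) ∈C Γ → Γ ⊢t Var x ∶ A

data _⊢ps_∶_ : Ctx → ℕ → Ty → Set where
  pss : (nil :: (0 , ⋆)) ⊢ps 0 ∶ ⋆
  psd : ∀ {Γ f A x y} → Γ ⊢ps f ∶ ⇒ A (Var x) (Var y) → Γ ⊢ps y ∶ A
  pse : ∀ {Γ x A} → Γ ⊢ps x ∶ A →
        ((Γ :: (ℓ Γ , A)) :: (suc (ℓ Γ) , ⇒ A (Var x) (Var (ℓ Γ))))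
          ⊢ps suc (ℓ Γ) ∶ ⇒ A (Var x) (Var (ℓ Γ))

_⊢ps : Ctx → Set
Γ ⊢ps = ∃ λ x → Γ ⊢ps x ∶ ⋆

◁₀ : Ctx → ℕ → ℕ → Set
◁₀ Γ x y =
  (Σ Ty λ A → Σ ℕ λ z → Γ ⊢t Var y ∶ ⇒ A (Var x) (Var z))
  ⊎ (Σ Ty λ A → Σ ℕ λ z → Γ ⊢t Var x ∶ ⇒ A (Var z) (Var y))

◁ : Ctx → ℕ → ℕ → Set
◁ Γ = TransClosure (◁₀ Γ)

IsLinearOrderOnVars : Ctx → (ℕ → ℕ → Set) → Set
IsLinearOrderOnVars Γ R =
  (∀ x → x ∈vars Γ → ¬ R x x)
  × (∀ x y z → x ∈vars Γ → y ∈vars Γ → z ∈vars Γ → R x y → R y z → R x z)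
  × (∀ x y → x ∈vars Γ → y ∈vars Γ → ¬ x ≡ y → R x y ⊎ R y x)

{-# OPTIONS --safe #-}
module Submission where

-- A ps-derivation builds its context by a depth-first traversal of a pasting scheme.
-- Along it we maintain an enumeration of the variables: the trail of variables that
-- leads by ◁₀-steps to the current variable x, followed by the targets of the type
-- of x that are still to be visited.  Every ◁₀-edge points forward in this list.
-- When the type of x is ⋆ there is nothing left to visit, so the whole list is a
-- ◁₀-path without repetitions; hence ◁ is "occurs earlier in the list", which is a
-- strict total order.

open import Defs
open import Level using (Level)
open import Function using (_∘_)
open import Data.Nat using (ℕ; suc; _<_; s≤s; z≤n)
open import Data.Nat.Properties using (<-irrefl; n<1+n; m<n⇒m<1+n)
open import Data.Product using (_,_)
open import Data.Sum as Sum using (_⊎_; inj₁; inj₂)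
open import Data.Empty using (⊥-elim)
open import Data.List using (List; []; _∷_; _++_; _∷ʳ_)
open import Data.List.Properties using (++-assoc; ++-identityʳ)
open import Data.List.Membership.Propositional using (_∈_; _∉_)
open import Data.List.Membership.Propositional.Properties using (∈-++⁺ʳ; ∈-insert)
open import Data.List.Relation.Unary.Any using (here; there)
open import Data.List.Relation.Unary.All as All using (All; []; _∷_)
import Data.List.Relation.Unary.All.Properties as Allₚ
open import Data.List.Relation.Unary.AllPairs using ([]; _∷_)
open import Data.List.Relation.Unary.Unique.Propositional using (Unique)
open import Data.List.Relation.Unary.Linked as Linked using (Linked; [-]; _∷_)
open import Data.List.Relation.Unary.Linked.Properties using (Linked⇒All)
open import Data.List.Relation.Binary.Sublist.Propositional as Sublist using (_⊆_; _∷_; ⊆-refl; lookup)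
open import Data.List.Relation.Binary.Sublist.Propositional.Properties using (++⁺; ++⁺ˡ)
open import Relation.Nullary using (¬_)
open import Relation.Binary.Core using (Rel)
open import Relation.Binary.PropositionalEquality using (_≡_; _≢_; refl; sym; trans; subst)
open import Relation.Binary.Construct.Closure.Transitive using (TransClosure; [_]; _∷_)
  renaming (_++_ to _⁺++_)

private
  variable
    a r : Level
    X : Set a
    u v w : X
    xs ys : List X
    Γ : Ctx
    A : Ty
    t₁ t₂ : Tm
    x y f : ℕ

infix 4 _≺[_]_

data _≺[_]_ {X : Set a} (u : X) : List X → X → Set a where
  here  : v ∈ xs → u ≺[ u ∷ xs ] v
  there : u ≺[ xs ] v → u ≺[ w ∷ xs ] v

≺⇒∈ʳ : u ≺[ xs ] v → v ∈ xs
≺⇒∈ʳ (here v∈) = there v∈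
≺⇒∈ʳ (there u≺v) = there (≺⇒∈ʳ u≺v)

≺-irrefl : Unique xs → ¬ u ≺[ xs ] u
≺-irrefl (u∉ ∷ _) (here u∈) = All.lookup u∉ u∈ refl
≺-irrefl (_ ∷ unique) (there u≺u) = ≺-irrefl unique u≺u

≺-trans : Unique xs → u ≺[ xs ] v → v ≺[ xs ] w → u ≺[ xs ] w
≺-trans (u∉ ∷ _) (here v∈) (here _) = ⊥-elim (All.lookup u∉ v∈ refl)
≺-trans _ (here _) (there v≺w) = here (≺⇒∈ʳ v≺w)
≺-trans (v∉ ∷ _) (there u≺v) (here _) = ⊥-elim (All.lookup v∉ (≺⇒∈ʳ u≺v) refl)
≺-trans (_ ∷ unique) (there u≺v) (there v≺w) = there (≺-trans unique u≺v v≺w)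

≺-connex : u ∈ xs → v ∈ xs → u ≢ v → u ≺[ xs ] v ⊎ v ≺[ xs ] u
≺-connex (here refl) (here refl) u≢v = ⊥-elim (u≢v refl)
≺-connex (here refl) (there v∈) _ = inj₁ (here v∈)
≺-connex (there u∈) (here refl) _ = inj₂ (here u∈)
≺-connex (there u∈) (there v∈) u≢v = Sum.map there there (≺-connex u∈ v∈ u≢v)

≺-resp-⊆ : xs ⊆ ys → u ≺[ xs ] v → u ≺[ ys ] v
≺-resp-⊆ (_ Sublist.∷ʳ xs⊆ys) u≺v = there (≺-resp-⊆ xs⊆ys u≺v)
≺-resp-⊆ (refl ∷ xs⊆ys) (here v∈) = here (lookup xs⊆ys v∈)
≺-resp-⊆ (refl ∷ xs⊆ys) (there u≺v) = there (≺-resp-⊆ xs⊆ys u≺v)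

∈⇒≺-++ : u ∈ xs → v ∈ ys → u ≺[ xs ++ ys ] v
∈⇒≺-++ (here refl) v∈ = here (∈-++⁺ʳ _ v∈)
∈⇒≺-++ (there u∈) v∈ = there (∈⇒≺-++ u∈ v∈)

module _ {R : Rel X r} where

  TransClosure⇒≺ : Unique xs → (∀ {u v} → R u v → u ≺[ xs ] v) →
                   TransClosure R u v → u ≺[ xs ] v
  TransClosure⇒≺ unique forward [ uRv ] = forward uRv
  TransClosure⇒≺ unique forward (uRw ∷ w⁺v) =
    ≺-trans unique (forward uRw) (TransClosure⇒≺ unique forward w⁺v)

  ≺⇒TransClosure : Linked R xs → u ≺[ xs ] v → TransClosure R u v
  ≺⇒TransClosure [-] (here ())
  ≺⇒TransClosure (uRw ∷ linked) (here v∈) =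
    All.lookup (Linked⇒All _⁺++_ [ uRw ] (Linked.map [_] linked)) v∈
  ≺⇒TransClosure linked (there u≺v) = ≺⇒TransClosure (Linked.tail linked) u≺v

  Linked-∷ʳ : ∀ xs → Linked R (xs ∷ʳ u) → R u v → Linked R (xs ∷ʳ u ∷ʳ v)
  Linked-∷ʳ [] [-] uRv = uRv ∷ [-]
  Linked-∷ʳ (_ ∷ []) (wRu ∷ linked) uRv = wRu ∷ Linked-∷ʳ [] linked uRv
  Linked-∷ʳ (_ ∷ w ∷ xs) (wRw ∷ linked) uRv = wRw ∷ Linked-∷ʳ (w ∷ xs) linked uRv

All-insert : ∀ {P : X → Set r} xs → P v → All P (xs ++ ys) → All P (xs ++ v ∷ ys)
All-insert xs Pv Pxsys = Allₚ.++⁺ (Allₚ.++⁻ˡ xs Pxsys) (Pv ∷ Allₚ.++⁻ʳ xs Pxsys)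

Unique-insert : ∀ xs → v ∉ xs ++ ys → Unique (xs ++ ys) → Unique (xs ++ v ∷ ys)
Unique-insert [] v∉ unique = Allₚ.¬Any⇒All¬ _ v∉ ∷ unique
Unique-insert (u ∷ xs) v∉ (u∉ ∷ unique) =
  All-insert xs (λ u≡v → v∉ (here (sym u≡v))) u∉ ∷ Unique-insert xs (v∉ ∘ there) unique

All<⇒∉ : ∀ {n} → All (_< n) xs → n ∉ xs
All<⇒∉ bounded n∈ = <-irrefl refl (All.lookup bounded n∈)

⊢T-weaken : ∀ {p} → Γ ⊢T A → (Γ :: p) ⊢ → (Γ :: p) ⊢T A
⊢T-weaken (ob _) ⊢Γp = ob ⊢Γp
⊢T-weaken (ar (var _ t∈) (var _ u∈)) ⊢Γp = ar (var ⊢Γp (there t∈)) (var ⊢Γp (there u∈))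

∈C⇒⊢T : Γ ⊢ → (x , A) ∈C Γ → Γ ⊢T A
∈C⇒⊢T ⊢Γp@(cc _ ⊢A _) here = ⊢T-weaken ⊢A ⊢Γp
∈C⇒⊢T ⊢Γp@(cc ⊢Γ _ _) (there x∈) = ⊢T-weaken (∈C⇒⊢T ⊢Γ x∈) ⊢Γp

⊢t⇒⊢ : Γ ⊢t t₁ ∶ A → Γ ⊢
⊢t⇒⊢ (var ⊢Γ _) = ⊢Γ

⊢t-Var⇒∈C : Γ ⊢t Var x ∶ A → (x , A) ∈C Γ
⊢t-Var⇒∈C (var _ x∈) = x∈

⊢t-target : Γ ⊢t t₁ ∶ ⇒ A t₂ (Var y) → Γ ⊢t Var y ∶ A
⊢t-target (var ⊢Γ f∈) with ∈C⇒⊢T ⊢Γ f∈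
... | ar _ ⊢y = ⊢y

Extend : Ctx → ℕ → Ty → Ctx
Extend Γ x A = Γ :: (ℓ Γ , A) :: (suc (ℓ Γ) , ⇒ A (Var x) (Var (ℓ Γ)))

⊢-Extend : Γ ⊢t Var x ∶ A → Extend Γ x A ⊢
⊢-Extend {Γ = Γ} {A = A} (var ⊢Γ x∈) = cc ⊢Γa (ar (var ⊢Γa (there x∈)) (var ⊢Γa here)) refl
  where
  ⊢Γa : (Γ :: (ℓ Γ , A)) ⊢
  ⊢Γa = cc ⊢Γ (∈C⇒⊢T ⊢Γ x∈) refl

⊢ps⇒⊢t : Γ ⊢ps x ∶ A → Γ ⊢t Var x ∶ A
⊢ps⇒⊢t pss = var (cc ec (ob ec) refl) here
⊢ps⇒⊢t (psd d) = ⊢t-target (⊢ps⇒⊢t d)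
⊢ps⇒⊢t (pse d) = var (⊢-Extend (⊢ps⇒⊢t d)) here

data Edge (Γ : Ctx) : ℕ → ℕ → Set where
  source : (f , ⇒ A (Var x) (Var y)) ∈C Γ → Edge Γ x f
  target : (f , ⇒ A (Var x) (Var y)) ∈C Γ → Edge Γ f y

◁₀⇒Edge : ◁₀ Γ x y → Edge Γ x y
◁₀⇒Edge (inj₁ (_ , _ , var _ y∈)) = source y∈
◁₀⇒Edge (inj₂ (_ , _ , var _ x∈)) = target x∈

Edge⇒◁₀ : Γ ⊢ → Edge Γ x y → ◁₀ Γ x y
Edge⇒◁₀ ⊢Γ (source f∈) = inj₁ (_ , _ , var ⊢Γ f∈)
Edge⇒◁₀ ⊢Γ (target f∈) = inj₂ (_ , _ , var ⊢Γ f∈)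

Edge-weaken : ∀ {p} → Edge Γ x y → Edge (Γ :: p) x y
Edge-weaken (source f∈) = source (there f∈)
Edge-weaken (target f∈) = target (there f∈)

targets : Ty → List ℕ
targets ⋆ = []
targets (⇒ A _ (Var y)) = y ∷ targets A

record PsOrder (Γ : Ctx) (x : ℕ) (A : Ty) : Set where
  field
    trail    : List ℕ
    order    : List ℕ
    shape    : order ≡ (trail ∷ʳ x) ++ targets A
    linked   : Linked (Edge Γ) (trail ∷ʳ x)
    unique   : Unique order
    bounded  : All (_< ℓ Γ) order   -- keeps the variables added by pse fresh
    forward  : ∀ {u v} → Edge Γ u v → u ≺[ order ] v
    complete : ∀ {v B} → (v , B) ∈C Γ → v ∈ order

PsOrder-pss : PsOrder (nil :: (0 , ⋆)) 0 ⋆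
PsOrder-pss = record
  { trail    = []
  ; order    = 0 ∷ []
  ; shape    = refl
  ; linked   = [-]
  ; unique   = [] ∷ []
  ; bounded  = s≤s z≤n ∷ []
  ; forward  = λ { (source (there ())) ; (target (there ())) }
  ; complete = λ { here → here refl ; (there ()) }
  }

PsOrder-psd : (f , ⇒ A (Var x) (Var y)) ∈C Γ →
              PsOrder Γ f (⇒ A (Var x) (Var y)) → PsOrder Γ y A
PsOrder-psd {A = A} {y = y} f∈ I = record
  { trail    = trail ∷ʳ _
  ; order    = order
  ; shape    = trans shape (sym (++-assoc (trail ∷ʳ _) (y ∷ []) (targets A)))
  ; linked   = Linked-∷ʳ trail linked (target f∈)
  ; unique   = unique
  ; bounded  = bounded
  ; forward  = forward
  ; complete = complete
  }
  where open PsOrder I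

-- The new variable ℓ Γ is parallel to x: its source precedes x, its target heads targets A.
Extend-forward : (x , A) ∈C Γ → x ∈ xs →
                 let ys = xs ++ suc (ℓ Γ) ∷ ℓ Γ ∷ targets A in
                 Unique ys → (∀ {u v} → Edge Γ u v → u ≺[ ys ] v) →
                 Edge (Extend Γ x A) u v → u ≺[ ys ] v
Extend-forward _ x∈xs _ _ (source here) = ∈⇒≺-++ x∈xs (here refl)
Extend-forward {xs = xs} _ _ _ _ (target here) = ≺-resp-⊆ (++⁺ˡ xs ⊆-refl) (here (here refl))
Extend-forward x∈ x∈xs unique forward (source (there here)) =
  ≺-trans unique (forward (source x∈)) (∈⇒≺-++ x∈xs (there (here refl)))
Extend-forward {xs = xs} _ _ _ _ (target (there here)) =
  ≺-resp-⊆ (++⁺ˡ xs ⊆-refl) (there (here (here refl)))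
Extend-forward _ _ _ forward (source (there (there f∈))) = forward (source f∈)
Extend-forward _ _ _ forward (target (there (there f∈))) = forward (target f∈)

PsOrder-pse : (x , A) ∈C Γ → PsOrder Γ x A →
              PsOrder (Extend Γ x A) (suc (ℓ Γ)) (⇒ A (Var x) (Var (ℓ Γ)))
PsOrder-pse {x = x} {A = A} {Γ = Γ} x∈ I = record
  { trail    = path
  ; order    = new
  ; shape    = sym (++-assoc path (suc n ∷ []) (n ∷ T))
  ; linked   = Linked-∷ʳ trail (Linked.map (Edge-weaken ∘ Edge-weaken) linked) (source here)
  ; unique   = unique′
  ; bounded  = All-insert path (n<1+n (suc n)) (All.map m<n⇒m<1+n bounded₁)
  ; forward  = Extend-forward x∈ x∈path unique′ (≺-resp-⊆ old⊆new ∘ forward)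
  ; complete = λ { here → ∈-++⁺ʳ path (here refl)
                 ; (there here) → ∈-++⁺ʳ path (there (here refl))
                 ; (there (there v∈)) → lookup old⊆new (complete v∈) }
  }
  where
  open PsOrder I
  n : ℕ
  n = ℓ Γ

  T path new : List ℕ
  T = targets A
  path = trail ∷ʳ x
  new = path ++ suc n ∷ n ∷ T

  x∈path : x ∈ path
  x∈path = ∈-insert trail

  old⊆new : order ⊆ new
  old⊆new = subst (_⊆ new) (sym shape) (++⁺ ⊆-refl (++⁺ˡ (suc n ∷ n ∷ []) ⊆-refl))

  bounded₀ : All (_< n) (path ++ T)
  bounded₀ = subst (All (_< n)) shape bounded

  bounded₁ : All (_< suc n) (path ++ n ∷ T)
  bounded₁ = All-insert path (n<1+n n) (All.map m<n⇒m<1+n bounded₀)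

  unique′ : Unique new
  unique′ = Unique-insert path (All<⇒∉ bounded₁)
              (Unique-insert path (All<⇒∉ bounded₀) (subst Unique shape unique))

psOrder : Γ ⊢ps x ∶ A → PsOrder Γ x A
psOrder pss = PsOrder-pss
psOrder (psd d) = PsOrder-psd (⊢t-Var⇒∈C (⊢ps⇒⊢t d)) (psOrder d)
psOrder (pse d) = PsOrder-pse (⊢t-Var⇒∈C (⊢ps⇒⊢t d)) (psOrder d)

mainTheorem15 : (Γ : Ctx) → Γ ⊢ps → IsLinearOrderOnVars Γ (◁ Γ)
mainTheorem15 Γ (x , d) =
    (λ u _ u◁u → ≺-irrefl unique (◁⇒≺ u◁u))
  , (λ _ _ _ _ _ _ → _⁺++_)
  , (λ u v (_ , u∈) (_ , v∈) u≢v → Sum.map ≺⇒◁ ≺⇒◁ (≺-connex (complete u∈) (complete v∈) u≢v))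
  where
  open PsOrder (psOrder d)

  order-linked : Linked (◁₀ Γ) order
  order-linked = subst (Linked (◁₀ Γ)) (sym (trans shape (++-identityʳ (trail ∷ʳ x))))
                   (Linked.map (Edge⇒◁₀ (⊢t⇒⊢ (⊢ps⇒⊢t d))) linked)

  ◁⇒≺ : ◁ Γ u v → u ≺[ order ] v
  ◁⇒≺ = TransClosure⇒≺ unique (forward ∘ ◁₀⇒Edge)

  ≺⇒◁ : u ≺[ order ] v → ◁ Γ u v
  ≺⇒◁ = ≺⇒TransClosure order-linked
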